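{- For all $k\in\mathbb{N}^+$, the Johnson graph $\mathfrak{J}(k)$, viewed as an $L_k$-structure, is homogeneous in the language $L_k$ (i.e., every $L_k$-isomorphism between finite substructures extends to an $L_k$-automorphism of $\mathfrak{J}(k)$).
   Context: For $k\in\mathbb{N}^+$, the Johnson graph $\mathfrak{J}(k)$ is the graph on vertex set $\mathbb{N}^{(k)}$ (the set of subsets of $\mathbb{N}$ of size $k$) in which, for $x,y\in\mathbb{N}^{(k)}$, $(x,y)$ is an edge if and only if $|x\cap y|=k-1$. For $i,j\in\mathbb{N}$ with $i\geq 2$ and $0\leq j\leq k-1$, let $E_{ij}$ be an $i$-ary relation symbol interpreted on $\mathbb{N}^{(k)}$ by $E_{ij}(x_1,\dots,x_i)$ if and only if $|x_1\cap\cdots\cap x_i|=j$ (so $E_{2,k-1}$ is the graph relation; all $E_{ij}$ are definable in the graph $\mathfrak{J}(k)$). Let $L_k:=\{E_{ij}: i,j\in\mathbb{N},\ 2\leq i\leq k+1,\ 0\leq j\leq k-1\}$, and regard $\mathfrak{J}(k)$ as an $L_k$-structure via these interpretations. -}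

module Defs where

open import Data.Nat using (ℕ; suc; _≤_; _<_)
open import Data.Fin using (Fin)
open import Data.List using (List; length)
open import Data.List.Membership.Propositional using (_∈_)
open import Data.List.Relation.Unary.Linked using (Linked)
open import Data.List.Relation.Unary.Unique.Propositional using (Unique)
open import Data.Product using (Σ; ∃; _×_)
open import Function using (_∘_; _⇔_)
open import Function.Definitions using (Injective; Bijective)
open import Relation.Binary.PropositionalEquality using (_≡_)

-- A k-element subset of ℕ, represented canonically by its strictly
-- increasing list of elements (so equal sets are equal vertices).
record KSet (k : ℕ) : Set where
  constructor kset
  field
    elems  : List ℕ
    sorted : Linked _<_ elems
    size   : length elems ≡ k
open KSet public

_∈ˢ_ : {k : ℕ} → ℕ → KSet k → Set
a ∈ˢ x = a ∈ elems x

HasSize : (ℕ → Set) → ℕ → Set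
HasSize P j = Σ (List ℕ) λ L → Unique L × (∀ a → (a ∈ L) ⇔ P a) × length L ≡ j

E : {k : ℕ} (i j : ℕ) → (Fin i → KSet k) → Set
E i j xs = HasSize (λ a → ∀ l → a ∈ˢ xs l) j

InLang : ℕ → ℕ → ℕ → Set
InLang k i j = (2 ≤ i) × (i ≤ suc k) × (j < k)

IsAutomorphism : (k : ℕ) → (KSet k → KSet k) → Set
IsAutomorphism k g =
  Bijective _≡_ _≡_ g ×
  (∀ i j → InLang k i j → (xs : Fin i → KSet k) → E i j xs ⇔ E i j (g ∘ xs))

-- the map a m ↦ b m (m : Fin n) is an L_k-isomorphism between the finite
-- substructures {a m} and {b m} of 𝔍(k)
IsFinitePartialIso : (k n : ℕ) → (Fin n → KSet k) → (Fin n → KSet k) → Set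
IsFinitePartialIso k n a b =
  Injective _≡_ _≡_ a × Injective _≡_ _≡_ b ×
  (∀ i j → InLang k i j → (t : Fin i → Fin n) → E i j (a ∘ t) ⇔ E i j (b ∘ t))

{-# OPTIONS --safe #-}
module Submission where

-- Record a family (a m)_{m<n} of k-sets by its colouring x ↦ {m ∣ x ∈ a m}.  For nonempty S the
-- intersection ⋂_{m∈S} a m is already the intersection of k+1 of its members (some a m₀ and, for
-- each element of a m₀ outside it, a member omitting that element), so the relations E_{k+1,j},
-- j < k, together with |⋂_{m∈S} b m| ≤ |b m₀| = k, give |⋂_{m∈S} a m| = |⋂_{m∈S} b m|.  Families
-- with equal intersection sizes differ by a permutation of ℕ: a point of largest colour in a has a
-- twin of the same colour in b; remove both and recurse.  That permutation acts on 𝔍(k) as an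
-- automorphism sending each a m to b m.

open import Defs
open import Data.Nat using (ℕ; zero; suc; _<_; _≤_; _≟_; _⊔_; z≤n; s≤s)
open import Data.Nat.Properties
  using ( ≤-refl; ≤-reflexive; ≤-trans; ≤-antisym; <-trans; <-≤-trans; <⇒≤; <⇒≢; <⇒≱; m≤n⇒m≤1+n
        ; m<n⇒m<1+n; m<1+n⇒m<n∨m≡n; m≤n⇒m<n∨m≡n; <-≤-connex; ≤∧≢⇒<; suc-injective; m≤m⊔n; m≤n⊔m
        ; ≡-irrelevant; <-irrelevant; ≤-totalOrder; ≤-decTotalOrder )
import Data.Bool.Properties as Bool
open import Data.Fin using (Fin; zero; suc; cast)
open import Data.Fin.Properties using (¬∀⟶∃¬; all?; cast-involutive)
open import Data.Fin.Subset using (Subset; ⊥; _∈_; _∉_; _⊆_; _⊈_; ∣_∣; Nonempty)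
open import Data.Fin.Subset.Properties
  using (_∈?_; _⊆?_; ⊆-refl; ⊆-antisym; ⊥⊆; nonempty?; Empty-unique; p⊆q⇒∣p∣≤∣q∣; p⊂q⇒∣p∣<∣q∣)
open import Data.List using (List; length; map; filter; downFrom; lookup; concat; tabulate)
open import Data.List.Properties using (length-map)
open import Data.List.Extrema ≤-totalOrder using (argmax; argmax-sel; f[⊥]≤f[argmax]; f[xs]≤f[argmax]; max; xs≤max)
open import Data.List.Membership.Propositional using () renaming (_∈_ to _∈ᴸ_)
open import Data.List.Membership.DecPropositional _≟_ using () renaming (_∈?_ to _∈ᴸ?_)
open import Data.List.Membership.Propositional.Properties
  using (∈-map⁺; ∈-map⁻; ∈-filter⁺; ∈-filter⁻; ∈-downFrom⁺; ∈-downFrom⁻; ∈-concat⁺′; ∈-tabulate⁺)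
open import Data.List.Membership.Propositional.Properties.WithK using (unique∧set⇒bag)
open import Data.List.Relation.Binary.BagAndSetEquality using (∼bag⇒↭)
open import Data.List.Relation.Binary.Equality.Propositional using (≋⇒≡)
open import Data.List.Relation.Binary.Permutation.Propositional using (_↭_; ↭⇒↭ₛ; ↭-sym)
open import Data.List.Relation.Binary.Permutation.Propositional.Properties using (↭-length; ∈-resp-↭)
import Data.List.Relation.Binary.Permutation.Setoid.Properties as ↭ₛ
import Data.List.Relation.Unary.All as All
import Data.List.Relation.Unary.AllPairs as AllPairs
open import Data.List.Relation.Unary.Any using (index)
open import Data.List.Relation.Unary.Any.Properties using (lookup-index)
open import Data.List.Relation.Unary.Linked as Linked using (Linked)
open import Data.List.Relation.Unary.Linked.Properties using (Linked⇒AllPairs; AllPairs⇒Linked)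
open import Data.List.Relation.Unary.Sorted.TotalOrder.Properties using (↗↭↗⇒≋)
open import Data.List.Relation.Unary.Unique.Propositional using (Unique)
import Data.List.Relation.Unary.Unique.Propositional.Properties as Unique
open import Data.List.Sort ≤-decTotalOrder using (sort; sort-↭; sort-↗)
open import Data.Product using (Σ; ∃; _×_; _,_; proj₁; proj₂)
open import Data.Sum using (inj₁; inj₂; [_,_]′)
import Data.Vec as Vec
open import Data.Vec.Properties using (≡-dec; lookup∘tabulate; []=⇒lookup; lookup⇒[]=)
open import Function using (_∘_; _$_; flip; _⇔_; mk⇔; Equivalence; _↔_; Inverse; mk↔ₛ′)
open import Function.Bundles using (Bijection; Injection)
open import Function.Construct.Composition using (_↔-∘_)
open import Function.Construct.Identity using (↔-id)
open import Function.Construct.Symmetry using (↔-sym)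
import Function.Properties.Equivalence as ⇔
open import Function.Properties.Inverse using (↔⇒⤖; ↔⇒↣)
open import Function.Related.Propositional using (module EquationalReasoning)
open import Relation.Nullary using (¬_; ¬?; Dec; yes; no; does; contradiction)
open import Relation.Nullary.Decidable using (decidable-stable; _→-dec_; toSum)
open import Relation.Unary using (Decidable)
open import Relation.Binary.PropositionalEquality
  using (_≡_; _≢_; refl; sym; trans; cong; cong₂; subst; setoid; module ≡-Reasoning)

private variable
  k n N u v x j : ℕ
  P Q : ℕ → Set

-- Counting below a bound

unique-∼set⇒↭ : ∀ {xs ys : List ℕ} → Unique xs → Unique ys → (∀ {a} → a ∈ᴸ xs ⇔ a ∈ᴸ ys) → xs ↭ ys
unique-∼set⇒↭ xs! ys! same = ∼bag⇒↭ (unique∧set⇒bag xs! ys! same)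

HasSize-cong : (∀ x → P x ⇔ Q x) → HasSize P j → HasSize Q j
HasSize-cong P⇔Q (xs , xs! , xs⇔P , ∣xs∣) = xs , xs! , (λ x → ⇔.trans (xs⇔P x) (P⇔Q x)) , ∣xs∣

HasSize-unique : ∀ {i} → HasSize P i → HasSize P j → i ≡ j
HasSize-unique (xs , xs! , xs⇔P , refl) (ys , ys! , ys⇔P , refl) =
  ↭-length (unique-∼set⇒↭ xs! ys! λ {a} → ⇔.trans (xs⇔P a) (⇔.sym (ys⇔P a)))

-- Opaque, so that unification sees countBelow P? N as rigid in N; the lemmas below are its interface.
opaque
  countBelow : Decidable P → ℕ → ℕ
  countBelow P? zero = zero
  countBelow P? (suc N) with P? N
  ... | yes _ = suc (countBelow P? N)
  ... | no _  = countBelow P? N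

  length-filter-downFrom : (P? : Decidable P) (N : ℕ) → length (filter P? (downFrom N)) ≡ countBelow P? N
  length-filter-downFrom P? zero = refl
  length-filter-downFrom P? (suc N) with P? N
  ... | yes _ = cong suc (length-filter-downFrom P? N)
  ... | no _  = length-filter-downFrom P? N

  countBelow-HasSize : (P? : Decidable P) (N : ℕ) → HasSize (λ x → x < N × P x) (countBelow P? N)
  countBelow-HasSize {P = P} P? N =
    filter P? (downFrom N) , Unique.filter⁺ P? (Unique.downFrom⁺ N) , members , length-filter-downFrom P? N
    where
    members : ∀ x → x ∈ᴸ filter P? (downFrom N) ⇔ (x < N × P x)
    members x = mk⇔ (λ x∈ → let x∈↓N , px = ∈-filter⁻ P? x∈ in ∈-downFrom⁻ x∈↓N , px)
                    (λ (x<N , px) → ∈-filter⁺ P? (∈-downFrom⁺ x<N) px)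

  countBelow-mono : (P? : Decidable P) (Q? : Decidable Q) → (∀ {x} → x < N → P x → Q x) →
                    countBelow P? N ≤ countBelow Q? N
  countBelow-mono {N = zero}  P? Q? P⇒Q = z≤n
  countBelow-mono {N = suc N} P? Q? P⇒Q with P? N | Q? N
  ... | yes _  | yes _  = s≤s (countBelow-mono P? Q? (P⇒Q ∘ m<n⇒m<1+n))
  ... | yes pN | no ¬qN = contradiction (P⇒Q ≤-refl pN) ¬qN
  ... | no _   | yes _  = m≤n⇒m≤1+n (countBelow-mono P? Q? (P⇒Q ∘ m<n⇒m<1+n))
  ... | no _   | no _   = countBelow-mono P? Q? (P⇒Q ∘ m<n⇒m<1+n)

  countBelow-cong : (P? : Decidable P) (Q? : Decidable Q) → (∀ {x} → x < N → P x ⇔ Q x) →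
                    countBelow P? N ≡ countBelow Q? N
  countBelow-cong P? Q? P⇔Q =
    ≤-antisym (countBelow-mono P? Q? (Equivalence.to ∘ P⇔Q)) (countBelow-mono Q? P? (Equivalence.from ∘ P⇔Q))

  countBelow-remove : (P? : Decidable P) (Q? : Decidable Q) → u < N → P u → ¬ Q u →
                      (∀ {x} → x ≢ u → P x ⇔ Q x) → countBelow P? N ≡ suc (countBelow Q? N)
  countBelow-remove {N = suc N} P? Q? u<1+N pu ¬qu P⇔Q with m<1+n⇒m<n∨m≡n u<1+N | P? N | Q? N
  ... | inj₂ refl | yes _  | no _   = cong suc (countBelow-cong P? Q? (P⇔Q ∘ <⇒≢))
  ... | inj₂ refl | _      | yes qu = contradiction qu ¬qu
  ... | inj₂ refl | no ¬pu | _      = contradiction pu ¬pu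
  ... | inj₁ u<N  | yes _  | yes _  = cong suc (countBelow-remove P? Q? u<N pu ¬qu P⇔Q)
  ... | inj₁ u<N  | no _   | no _   = countBelow-remove P? Q? u<N pu ¬qu P⇔Q
  ... | inj₁ u<N  | yes pN | no ¬qN = contradiction (Equivalence.to (P⇔Q (<⇒≢ u<N ∘ sym)) pN) ¬qN
  ... | inj₁ u<N  | no ¬pN | yes qN = contradiction (Equivalence.from (P⇔Q (<⇒≢ u<N ∘ sym)) qN) ¬pN

  countBelow>0 : (P? : Decidable P) → x < N → P x → 0 < countBelow P? N
  countBelow>0 {N = suc N} P? x<1+N px with P? N | m<1+n⇒m<n∨m≡n x<1+N
  ... | yes _  | _         = s≤s z≤n
  ... | no ¬pN | inj₁ x<N  = countBelow>0 P? x<N px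
  ... | no ¬pN | inj₂ refl = contradiction px ¬pN

  countBelow>0⇒∃ : (P? : Decidable P) → 0 < countBelow P? N → ∃ λ x → x < N × P x
  countBelow>0⇒∃ {N = suc N} P? pos with P? N
  ... | yes pN = N , ≤-refl , pN
  ... | no _   = let x , x<N , px = countBelow>0⇒∃ P? pos in x , m<n⇒m<1+n x<N , px

countBelow-size : (P? : Decidable P) → (∀ {x} → P x → x < N) → HasSize P j → countBelow P? N ≡ j
countBelow-size P? P⇒<N hasSize =
  HasSize-unique (countBelow-HasSize P? _) (HasSize-cong (λ x → mk⇔ (λ px → P⇒<N px , px) proj₂) hasSize)

countBelow-≤-size : (P? : Decidable P) (Q? : Decidable Q) → (∀ {x} → Q x → x < N) → HasSize Q j →
                    (∀ {x} → P x → Q x) → countBelow P? N ≤ j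
countBelow-≤-size P? Q? Q⇒<N hasSize P⇒Q =
  ≤-trans (countBelow-mono P? Q? (λ _ → P⇒Q)) (≤-reflexive (countBelow-size Q? Q⇒<N hasSize))

∃-resp-countBelow : {P? : Decidable P} {Q? : Decidable Q} →
                    countBelow P? N ≡ countBelow Q? N → x < N → P x → ∃ λ y → y < N × Q y
∃-resp-countBelow {P? = P?} {Q?} same x<N px = countBelow>0⇒∃ Q? (subst (0 <_) same (countBelow>0 P? x<N px))

module _ {p q : Subset n} where

  ⊈⇒∃∉ : p ⊈ q → ∃ λ m → m ∈ p × m ∉ q
  ⊈⇒∃∉ p⊈q =
    let m , m∈p↛m∈q = ¬∀⟶∃¬ n _ (λ m → m ∈? p →-dec m ∈? q) (λ p⇒q → p⊈q (p⇒q _))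
    in m , decidable-stable (m ∈? p) (λ m∉p → m∈p↛m∈q (flip contradiction m∉p)) ,
       m∈p↛m∈q ∘ (λ m∈q _ → m∈q)

  ⊆∧∣∣≤⇒≡ : p ⊆ q → ∣ q ∣ ≤ ∣ p ∣ → p ≡ q
  ⊆∧∣∣≤⇒≡ p⊆q ∣q∣≤∣p∣ = ⊆-antisym p⊆q λ {m} m∈q →
    decidable-stable (m ∈? p) λ m∉p → <⇒≱ (p⊂q⇒∣p∣<∣q∣ (p⊆q , m , m∈q , m∉p)) ∣q∣≤∣p∣

module _ {p : Subset n} where

  ≢⊥⇒Nonempty : p ≢ ⊥ → Nonempty p
  ≢⊥⇒Nonempty p≢⊥ = decidable-stable (nonempty? p) (p≢⊥ ∘ Empty-unique)

  ⊆⊥⇒≡⊥ : p ⊆ ⊥ → p ≡ ⊥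
  ⊆⊥⇒≡⊥ p⊆⊥ = ⊆-antisym p⊆⊥ ⊥⊆

_≟⊥ : (p : Subset n) → Dec (p ≡ ⊥)
p ≟⊥ = ≡-dec Bool._≟_ p ⊥

_≢⊥? : (p : Subset n) → Dec (p ≢ ⊥)
p ≢⊥? = ¬? (p ≟⊥)

transpose : ℕ → ℕ → ℕ → ℕ
transpose p q x with x ≟ p | x ≟ q
... | yes _ | _     = q
... | no _  | yes _ = p
... | no _  | no _  = x

transpose-left : ∀ p q → transpose p q p ≡ q
transpose-left p q with p ≟ p
... | yes _  = refl
... | no p≢p = contradiction refl p≢p

transpose-right : ∀ p q → transpose p q q ≡ p
transpose-right p q with q ≟ p | q ≟ q
... | yes q≡p | _      = q≡p
... | no _    | yes _  = refl
... | no _    | no q≢q = contradiction refl q≢q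

transpose-other : ∀ {p q x} → x ≢ p → x ≢ q → transpose p q x ≡ x
transpose-other {p} {q} {x} x≢p x≢q with x ≟ p | x ≟ q
... | yes x≡p | _       = contradiction x≡p x≢p
... | no _    | yes x≡q = contradiction x≡q x≢q
... | no _    | no _    = refl

transpose-involutive : ∀ p q x → transpose p q (transpose p q x) ≡ x
transpose-involutive p q x with x ≟ p | x ≟ q
... | yes refl | _        = transpose-right x q
... | no _     | yes refl = transpose-left p x
... | no x≢p   | no x≢q   = transpose-other x≢p x≢q

transposition : ℕ → ℕ → ℕ ↔ ℕ
transposition p q = mk↔ₛ′ (transpose p q) (transpose p q) (transpose-involutive p q) (transpose-involutive p q)

-- Colourings of ℕ

-- A family (Aₘ)_{m < n} of subsets of ℕ, given by x ↦ {m ∣ x ∈ Aₘ}.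
Colouring : ℕ → Set
Colouring n = ℕ → Subset n

private variable
  τ τ' : Colouring n

BoundedBy : ℕ → Colouring n → Set
BoundedBy N τ = ∀ {x} → N ≤ x → τ x ≡ ⊥

SameIntersectionSizes : ℕ → Colouring n → Colouring n → Set
SameIntersectionSizes N τ τ' = ∀ {S} → S ≢ ⊥ → countBelow ((S ⊆?_) ∘ τ) N ≡ countBelow ((S ⊆?_) ∘ τ') N

_≅_ : Colouring n → Colouring n → Set
τ ≅ τ' = Σ (ℕ ↔ ℕ) λ π → ∀ x → τ' (Inverse.to π x) ≡ τ x

BoundedBy-≡⊥ : BoundedBy N τ → (∀ {x} → x < N → τ x ≡ ⊥) → ∀ x → τ x ≡ ⊥
BoundedBy-≡⊥ {N = N} bounded ≡⊥-below x = [ ≡⊥-below , bounded ]′ (<-≤-connex x N)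

maximalPoint : (τ : Colouring n) → x < N →
               ∃ λ u → u < N × ∣ τ x ∣ ≤ ∣ τ u ∣ × ∀ {y} → y < N → ∣ τ y ∣ ≤ ∣ τ u ∣
maximalPoint {x = x} {N} τ x<N =
  best , best<N , f[⊥]≤f[argmax] {f = ∣_∣ ∘ τ} x (downFrom N) ,
  λ y<N → All.lookup (f[xs]≤f[argmax] {f = ∣_∣ ∘ τ} x (downFrom N)) (∈-downFrom⁺ y<N)
  where
  best = argmax (∣_∣ ∘ τ) x (downFrom N)
  best<N : best < N
  best<N with argmax-sel (∣_∣ ∘ τ) x (downFrom N)
  ... | inj₁ best≡x  = subst (_< N) (sym best≡x) x<N
  ... | inj₂ best∈↓N = ∈-downFrom⁻ best∈↓N

-- Some v realises τ u ⊆ τ' v; then S = τ' v is realised by some τ w ⊇ τ' v, and maximality of u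
-- squeezes τ u ⊆ τ' v ⊆ τ w into equalities.
matchingPoint : SameIntersectionSizes N τ τ' → u < N → (∀ {x} → x < N → ∣ τ x ∣ ≤ ∣ τ u ∣) → τ u ≢ ⊥ →
                ∃ λ v → v < N × τ' v ≡ τ u
matchingPoint {τ = τ} {τ'} same u<N maximal τu≢⊥ =
  let v , v<N , τu⊆τ'v = ∃-resp-countBelow (same τu≢⊥) u<N ⊆-refl
      τ'v≢⊥ = λ τ'v≡⊥ → τu≢⊥ (⊆⊥⇒≡⊥ (subst (τ _ ⊆_) τ'v≡⊥ τu⊆τ'v))
      w , w<N , τ'v⊆τw = ∃-resp-countBelow (sym (same τ'v≢⊥)) v<N ⊆-refl
  in v , v<N , sym (⊆∧∣∣≤⇒≡ τu⊆τ'v (≤-trans (p⊆q⇒∣p∣≤∣q∣ τ'v⊆τw) (maximal w<N)))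

erase : ℕ → Colouring n → Colouring n
erase u τ x with x ≟ u
... | yes _ = ⊥
... | no _  = τ x

erase-self : ∀ u (τ : Colouring n) → erase u τ u ≡ ⊥
erase-self u τ with u ≟ u
... | yes _  = refl
... | no u≢u = contradiction refl u≢u

erase-other : x ≢ u → erase u τ x ≡ τ x
erase-other {x = x} {u} x≢u with x ≟ u
... | yes x≡u = contradiction x≡u x≢u
... | no _    = refl

erase-BoundedBy : u < N → BoundedBy N τ → BoundedBy N (erase u τ)
erase-BoundedBy u<N bounded N≤x = trans (erase-other (λ x≡u → <⇒≱ u<N (subst (_ ≤_) x≡u N≤x))) (bounded N≤x)

≅-from-erased : τ' v ≡ τ u → erase u τ ≅ erase v τ' → τ ≅ τ'
≅-from-erased {τ' = τ'} {v = v} {τ = τ} {u = u} τ'v≡τu (π , π-ok) = transposition πu v ↔-∘ π , ok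
  where
  open Inverse π using (to)
  open Injection (↔⇒↣ π) using (injective)
  open ≡-Reasoning
  πu = to u
  ok : ∀ x → τ' (transpose πu v (to x)) ≡ τ x
  ok x with x ≟ u
  ... | yes refl = trans (cong τ' (transpose-left πu v)) τ'v≡τu
  ... | no x≢u   = [ hits-v , misses-v ]′ (toSum (to x ≟ v))
    where
    misses-v : to x ≢ v → τ' (transpose πu v (to x)) ≡ τ x
    misses-v πx≢v = begin
      τ' (transpose πu v (to x)) ≡⟨ cong τ' (transpose-other (x≢u ∘ injective) πx≢v) ⟩
      τ' (to x)                  ≡⟨ erase-other πx≢v ⟨
      erase v τ' (to x)          ≡⟨ π-ok x ⟩
      erase u τ x                ≡⟨ erase-other x≢u ⟩
      τ x                        ∎
    hits-v : to x ≡ v → τ' (transpose πu v (to x)) ≡ τ x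
    hits-v πx≡v = begin
      τ' (transpose πu v (to x)) ≡⟨ cong (τ' ∘ transpose πu v) πx≡v ⟩
      τ' (transpose πu v v)      ≡⟨ cong τ' (transpose-right πu v) ⟩
      τ' πu                      ≡⟨ erase-other (λ πu≡v → x≢u (injective (trans πx≡v (sym πu≡v)))) ⟨
      erase v τ' πu              ≡⟨ π-ok u ⟩
      erase u τ u                ≡⟨ erase-self u τ ⟩
      ⊥                          ≡⟨ erase-self v τ' ⟨
      erase v τ' v               ≡⟨ cong (erase v τ') πx≡v ⟨
      erase v τ' (to x)          ≡⟨ π-ok x ⟩
      erase u τ x                ≡⟨ erase-other x≢u ⟩
      τ x                        ∎

module _ {S : Subset n} where

  ⊆-erase : x ≢ u → S ⊆ erase u τ x ⇔ S ⊆ τ x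
  ⊆-erase {x = x} {u = u} {τ = τ} x≢u = subst (λ p → S ⊆ erase u τ x ⇔ S ⊆ p) (erase-other x≢u) ⇔.refl

  ⊈-erase-self : S ≢ ⊥ → S ⊈ erase u τ u
  ⊈-erase-self {u = u} {τ = τ} S≢⊥ S⊆ = S≢⊥ (⊆⊥⇒≡⊥ (subst (S ⊆_) (erase-self u τ) S⊆))

  countBelow-⊆-erase : u < N → S ≢ ⊥ → S ⊆ τ u →
                       countBelow ((S ⊆?_) ∘ τ) N ≡ suc (countBelow ((S ⊆?_) ∘ erase u τ) N)
  countBelow-⊆-erase {u = u} {τ = τ} u<N S≢⊥ S⊆τu =
    countBelow-remove ((S ⊆?_) ∘ τ) ((S ⊆?_) ∘ erase u τ) u<N S⊆τu (⊈-erase-self {u = u} {τ = τ} S≢⊥)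
      (⇔.sym ∘ ⊆-erase)

  countBelow-⊈-erase : S ≢ ⊥ → S ⊈ τ u → countBelow ((S ⊆?_) ∘ τ) N ≡ countBelow ((S ⊆?_) ∘ erase u τ) N
  countBelow-⊈-erase {τ = τ} {u = u} {N = N} S≢⊥ S⊈τu = countBelow-cong ((S ⊆?_) ∘ τ) ((S ⊆?_) ∘ erase u τ) same
    where
    same : ∀ {x} → x < N → S ⊆ τ x ⇔ S ⊆ erase u τ x
    same {x} _ with toSum (x ≟ u)
    ... | inj₁ refl = mk⇔ (flip contradiction S⊈τu) (flip contradiction (⊈-erase-self {u = u} {τ = τ} S≢⊥))
    ... | inj₂ x≢u  = ⇔.sym (⊆-erase x≢u)

erase-SameIntersectionSizes : u < N → v < N → τ' v ≡ τ u →
  SameIntersectionSizes N τ τ' → SameIntersectionSizes N (erase u τ) (erase v τ')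
erase-SameIntersectionSizes {u = u} {N = N} {v = v} {τ' = τ'} {τ = τ} u<N v<N τ'v≡τu same {S} S≢⊥
  with S ⊆? τ u
... | yes S⊆τu = suc-injective $ begin
  suc (countBelow ((S ⊆?_) ∘ erase u τ) N)   ≡⟨ countBelow-⊆-erase u<N S≢⊥ S⊆τu ⟨
  countBelow ((S ⊆?_) ∘ τ) N                 ≡⟨ same S≢⊥ ⟩
  countBelow ((S ⊆?_) ∘ τ') N                ≡⟨ countBelow-⊆-erase v<N S≢⊥ (subst (S ⊆_) (sym τ'v≡τu) S⊆τu) ⟩
  suc (countBelow ((S ⊆?_) ∘ erase v τ') N)  ∎
  where open ≡-Reasoning
... | no S⊈τu = begin
  countBelow ((S ⊆?_) ∘ erase u τ) N   ≡⟨ countBelow-⊈-erase {τ = τ} {u = u} {N = N} S≢⊥ S⊈τu ⟨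
  countBelow ((S ⊆?_) ∘ τ) N           ≡⟨ same S≢⊥ ⟩
  countBelow ((S ⊆?_) ∘ τ') N          ≡⟨ countBelow-⊈-erase {τ = τ'} {u = v} {N = N} S≢⊥ (S⊈τu ∘ subst (S ⊆_) τ'v≡τu) ⟩
  countBelow ((S ⊆?_) ∘ erase v τ') N  ∎
  where open ≡-Reasoning

countBelow-≢⊥-erase : u < N → τ u ≢ ⊥ → countBelow (_≢⊥? ∘ τ) N ≡ suc (countBelow (_≢⊥? ∘ erase u τ) N)
countBelow-≢⊥-erase {u = u} {τ = τ} u<N τu≢⊥ =
  countBelow-remove (_≢⊥? ∘ τ) (_≢⊥? ∘ erase u τ) u<N τu≢⊥ (λ ne → ne (erase-self u τ))
    (λ x≢u → subst (λ p → τ _ ≢ ⊥ ⇔ p ≢ ⊥) (sym (erase-other x≢u)) ⇔.refl)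

empty⇒≅ : BoundedBy N τ → BoundedBy N τ' → SameIntersectionSizes N τ τ' → countBelow (_≢⊥? ∘ τ) N ≡ 0 → τ ≅ τ'
empty⇒≅ {N = N} {τ = τ} {τ' = τ'} bounded bounded' same none = ↔-id ℕ , λ x → trans (τ'≡⊥ x) (sym (τ≡⊥ x))
  where
  τ≡⊥ : ∀ x → τ x ≡ ⊥
  τ≡⊥ = BoundedBy-≡⊥ bounded λ {x} x<N → decidable-stable (τ x ≟⊥) λ τx≢⊥ →
    <⇒≢ (countBelow>0 (_≢⊥? ∘ τ) x<N τx≢⊥) (sym none)
  τ'≡⊥ : ∀ x → τ' x ≡ ⊥
  τ'≡⊥ = BoundedBy-≡⊥ bounded' λ {x} x<N → decidable-stable (τ' x ≟⊥) λ τ'x≢⊥ →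
    let w , _ , τ'x⊆τw = ∃-resp-countBelow (sym (same τ'x≢⊥)) x<N ⊆-refl
    in τ'x≢⊥ (⊆⊥⇒≡⊥ (subst (τ' x ⊆_) (τ≡⊥ w) τ'x⊆τw))

sameIntersectionSizes⇒≅ : BoundedBy N τ → BoundedBy N τ' → SameIntersectionSizes N τ τ' → τ ≅ τ'
sameIntersectionSizes⇒≅ = go _ refl
  where
  go : ∀ {N} {τ τ' : Colouring n} c → countBelow (_≢⊥? ∘ τ) N ≡ c →
       BoundedBy N τ → BoundedBy N τ' → SameIntersectionSizes N τ τ' → τ ≅ τ'
  go zero none bounded bounded' same = empty⇒≅ bounded bounded' same none
  go {N = N} {τ = τ} {τ' = τ'} (suc c) #τ≡1+c bounded bounded' same =
    let w , w<N , τw≢⊥ = countBelow>0⇒∃ (_≢⊥? ∘ τ) (subst (0 <_) (sym #τ≡1+c) (s≤s z≤n))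
        u , u<N , ∣τw∣≤∣τu∣ , maximal = maximalPoint τ w<N
        τu≢⊥ = λ τu≡⊥ → τw≢⊥ (sym (⊆∧∣∣≤⇒≡ ⊥⊆ (subst (λ p → ∣ τ w ∣ ≤ ∣ p ∣) τu≡⊥ ∣τw∣≤∣τu∣)))
        v , v<N , τ'v≡τu = matchingPoint same u<N maximal τu≢⊥
    in ≅-from-erased τ'v≡τu
         (go c (suc-injective (trans (sym (countBelow-≢⊥-erase u<N τu≢⊥)) #τ≡1+c))
             (erase-BoundedBy u<N bounded) (erase-BoundedBy v<N bounded')
             (erase-SameIntersectionSizes u<N v<N τ'v≡τu same))

-- k-sets and permutations of ℕ

strictlySorted⇒Unique : ∀ {xs} → Linked _<_ xs → Unique xs
strictlySorted⇒Unique xs< = AllPairs.map <⇒≢ (Linked⇒AllPairs <-trans xs<)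

sorted∧Unique⇒strictlySorted : ∀ {xs} → Linked _≤_ xs → Unique xs → Linked _<_ xs
sorted∧Unique⇒strictlySorted xs≤ xs! =
  AllPairs⇒Linked (AllPairs.zipWith (λ (m≤n , m≢n) → ≤∧≢⇒< m≤n m≢n) (Linked⇒AllPairs ≤-trans xs≤ , xs!))

strictlySorted-≡ : ∀ {xs ys} → Linked _<_ xs → Linked _<_ ys → (∀ {a} → a ∈ᴸ xs ⇔ a ∈ᴸ ys) → xs ≡ ys
strictlySorted-≡ xs< ys< same =
  ≋⇒≡ (↗↭↗⇒≋ ≤-totalOrder (Linked.map <⇒≤ xs<) (Linked.map <⇒≤ ys<)
        (↭⇒↭ₛ (unique-∼set⇒↭ (strictlySorted⇒Unique xs<) (strictlySorted⇒Unique ys<) same)))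

elems-Unique : (x : KSet k) → Unique (elems x)
elems-Unique x = strictlySorted⇒Unique (sorted x)

∈ˢ-HasSize : (x : KSet k) → HasSize (_∈ˢ x) k
∈ˢ-HasSize x = elems x , elems-Unique x , (λ _ → ⇔.refl) , size x

KSet-≡ : {x y : KSet k} → (∀ {a} → a ∈ˢ x ⇔ a ∈ˢ y) → x ≡ y
KSet-≡ {x = kset xs xs< refl} {kset ys ys< ∣ys∣} same with strictlySorted-≡ xs< ys< same
... | refl = cong₂ (kset xs) (Linked.irrelevant <-irrelevant xs< ys<) (≡-irrelevant refl ∣ys∣)

∈-sort : ∀ {xs a} → a ∈ᴸ sort xs ⇔ a ∈ᴸ xs
∈-sort {xs} = mk⇔ (∈-resp-↭ (sort-↭ xs)) (∈-resp-↭ (↭-sym (sort-↭ xs)))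

sort-strictlySorted : ∀ {xs} → Unique xs → Linked _<_ (sort xs)
sort-strictlySorted {xs} xs! =
  sorted∧Unique⇒strictlySorted (sort-↗ xs) (↭ₛ.Unique-resp-↭ (setoid ℕ) (↭⇒↭ₛ (↭-sym (sort-↭ xs))) xs!)

module _ (π : ℕ ↔ ℕ) where
  open Inverse π using (to; from; strictlyInverseˡ; strictlyInverseʳ)

  ∈-map-↔ : ∀ {xs a} → a ∈ᴸ map to xs ⇔ from a ∈ᴸ xs
  ∈-map-↔ {xs} {a} = mk⇔ to⁻ (subst (_∈ᴸ map to xs) (strictlyInverseˡ a) ∘ ∈-map⁺ to)
    where
    to⁻ : a ∈ᴸ map to xs → from a ∈ᴸ xs
    to⁻ a∈ with ∈-map⁻ to a∈
    ... | y , y∈xs , refl = subst (_∈ᴸ xs) (sym (strictlyInverseʳ y)) y∈xs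

  map-Unique : ∀ {xs} → Unique xs → Unique (map to xs)
  map-Unique = Unique.map⁺ (Injection.injective (↔⇒↣ π))

  HasSize-map : HasSize P j → HasSize (P ∘ from) j
  HasSize-map (xs , xs! , xs⇔P , ∣xs∣) =
    map to xs , map-Unique xs! , (λ a → ⇔.trans ∈-map-↔ (xs⇔P (from a))) , trans (length-map to xs) ∣xs∣

  image : KSet k → KSet k
  image x = kset (sort (map to (elems x))) (sort-strictlySorted (map-Unique (elems-Unique x)))
    (trans (↭-length (sort-↭ _)) (trans (length-map to (elems x)) (size x)))

  ∈-image : {x : KSet k} → ∀ {a} → a ∈ˢ image x ⇔ from a ∈ˢ x
  ∈-image = ⇔.trans ∈-sort ∈-map-↔

HasSize-resp-↔ : (π : ℕ ↔ ℕ) → HasSize P j ⇔ HasSize (P ∘ Inverse.from π) j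
HasSize-resp-↔ {P = P} π = mk⇔ (HasSize-map π) (HasSize-cong from∘to ∘ HasSize-map (↔-sym π))
  where
  from∘to : ∀ a → P (Inverse.from π (Inverse.to π a)) ⇔ P a
  from∘to a = mk⇔ (subst P (Inverse.strictlyInverseʳ π a)) (subst P (sym (Inverse.strictlyInverseʳ π a)))

image-image : (π ρ : ℕ ↔ ℕ) → (∀ a → Inverse.from ρ (Inverse.from π a) ≡ a) →
              (x : KSet k) → image π (image ρ x) ≡ x
image-image π ρ inverse x = KSet-≡ λ {a} →
  ⇔.trans (∈-image π {x = image ρ x})
    (⇔.trans (∈-image ρ {x = x}) (subst (λ b → b ∈ˢ x ⇔ a ∈ˢ x) (sym (inverse a)) ⇔.refl))

image-↔ : ℕ ↔ ℕ → KSet k ↔ KSet k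
image-↔ π = mk↔ₛ′ (image π) (image (↔-sym π))
  (image-image π (↔-sym π) (Inverse.strictlyInverseˡ π)) (image-image (↔-sym π) π (Inverse.strictlyInverseʳ π))

∀-⇔ : {I : Set} {A B : I → Set} → (∀ i → A i ⇔ B i) → (∀ i → A i) ⇔ (∀ i → B i)
∀-⇔ A⇔B = mk⇔ (λ a i → Equivalence.to (A⇔B i) (a i)) (λ b i → Equivalence.from (A⇔B i) (b i))

image-preserves-E : (π : ℕ ↔ ℕ) → ∀ i j (xs : Fin i → KSet k) → E i j xs ⇔ E i j (image π ∘ xs)
image-preserves-E π i j xs =
  ⇔.trans (HasSize-resp-↔ π) (mk⇔ (HasSize-cong ⋂-image) (HasSize-cong (⇔.sym ∘ ⋂-image)))
  where
  ⋂-image : ∀ a → (∀ l → Inverse.from π a ∈ˢ xs l) ⇔ (∀ l → a ∈ˢ image π (xs l))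
  ⋂-image a = ∀-⇔ λ l → ⇔.sym (∈-image π {x = xs l})

image-isAutomorphism : (π : ℕ ↔ ℕ) → IsAutomorphism k (image π)
image-isAutomorphism π = Bijection.bijective (↔⇒⤖ (image-↔ π)) , λ i j _ → image-preserves-E π i j

-- Finite families of k-sets

_∈ˢ?_ : (a : ℕ) (x : KSet k) → Dec (a ∈ˢ x)
a ∈ˢ? x = a ∈ᴸ? elems x

_‼_ : KSet k → Fin k → ℕ
x ‼ r = lookup (elems x) (cast (sym (size x)) r)

∈ˢ⇒‼ : ∀ {a} {x : KSet k} → a ∈ˢ x → ∃ λ r → x ‼ r ≡ a
∈ˢ⇒‼ {x = x} a∈x = cast (size x) (index a∈x) ,
  trans (cong (lookup (elems x)) (cast-involutive (sym (size x)) (size x) (index a∈x))) (sym (lookup-index a∈x))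

∈-tabulate-does : ∀ {P : Fin n → Set} (P? : Decidable P) {m} → m ∈ Vec.tabulate (does ∘ P?) ⇔ P m
∈-tabulate-does P? {m} with P? m | lookup∘tabulate (does ∘ P?) m
... | yes pm | lookup≡true  = mk⇔ (λ _ → pm) (λ _ → lookup⇒[]= m _ lookup≡true)
... | no ¬pm | lookup≡false = mk⇔ (λ m∈ → contradiction (trans (sym lookup≡false) ([]=⇒lookup m∈)) λ ())
                                  (flip contradiction ¬pm)

colouring : (Fin n → KSet k) → Colouring n
colouring a x = Vec.tabulate (does ∘ λ m → x ∈ˢ? a m)

∈-colouring : {a : Fin n → KSet k} → ∀ {x m} → m ∈ colouring a x ⇔ x ∈ˢ a m
∈-colouring {a = a} {x} = ∈-tabulate-does (λ m → x ∈ˢ? a m)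

AllBelow : ℕ → (Fin n → KSet k) → Set
AllBelow N a = ∀ {m x} → x ∈ˢ a m → x < N

bound : (Fin n → KSet k) → ℕ
bound a = suc (max 0 (concat (tabulate (elems ∘ a))))

AllBelow-bound : (a : Fin n → KSet k) → AllBelow (bound a) a
AllBelow-bound a {m} x∈am = s≤s (All.lookup (xs≤max 0 _) (∈-concat⁺′ x∈am (∈-tabulate⁺ {f = elems ∘ a} m)))

colouring-BoundedBy : {a : Fin n → KSet k} → AllBelow N a → BoundedBy N (colouring a)
colouring-BoundedBy {a = a} below N≤x =
  Empty-unique λ (m , m∈) → <⇒≱ (below (Equivalence.to (∈-colouring {a = a}) m∈)) N≤x

record ShortIntersection (a : Fin n → KSet k) (S : Subset n) : Set where
  field
    t     : Fin (suc k) → Fin n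
    t∈S   : ∀ l → t l ∈ S
    ⋂t⊆⋂S : ∀ {x} → (∀ l → x ∈ˢ a (t l)) → S ⊆ colouring a x

-- t 0 = m₀, and t (r+1) is a member of S whose set omits the r-th element of a m₀, if there is one.
shortIntersection : (a : Fin n → KSet k) {S : Subset n} {m₀ : Fin n} → m₀ ∈ S → ShortIntersection a S
shortIntersection {n = n} {k = k} a {S} {m₀} m₀∈S = record { t = t ; t∈S = t∈S ; ⋂t⊆⋂S = ⋂t⊆⋂S }
  where
  separator : ∀ z → ∃ λ m → m ∈ S × (z ∈ˢ a m → S ⊆ colouring a z)
  separator z with S ⊆? colouring a z
  ... | yes S⊆ = m₀ , m₀∈S , λ _ → S⊆
  ... | no S⊈  = let m , m∈S , m∉ = ⊈⇒∃∉ S⊈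
                 in m , m∈S , λ z∈am → contradiction (Equivalence.from (∈-colouring {a = a}) z∈am) m∉
  t : Fin (suc k) → Fin n
  t zero    = m₀
  t (suc r) = proj₁ (separator (a m₀ ‼ r))
  t∈S : ∀ l → t l ∈ S
  t∈S zero    = m₀∈S
  t∈S (suc r) = proj₁ (proj₂ (separator (a m₀ ‼ r)))
  ⋂t⊆⋂S : ∀ {x} → (∀ l → x ∈ˢ a (t l)) → S ⊆ colouring a x
  ⋂t⊆⋂S x∈⋂ =
    let r , a‼r≡x = ∈ˢ⇒‼ {x = a m₀} (x∈⋂ zero)
        separates = proj₂ (proj₂ (separator (a m₀ ‼ r)))
    in subst (λ z → S ⊆ colouring a z) a‼r≡x (separates (subst (_∈ˢ a (t (suc r))) (sym a‼r≡x) (x∈⋂ (suc r))))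

PreservesE : ℕ → (a b : Fin n → KSet k) → Set
PreservesE {n} {k} i a b = ∀ j → j < k → (t : Fin i → Fin n) → E i j (a ∘ t) → E i j (b ∘ t)

⋂-countBelow-≤ : {a b : Fin n → KSet k} → AllBelow N a → AllBelow N b → PreservesE (suc k) a b →
                 ∀ {S} → S ≢ ⊥ → countBelow ((S ⊆?_) ∘ colouring b) N ≤ countBelow ((S ⊆?_) ∘ colouring a) N
⋂-countBelow-≤ {n = n} {k = k} {N = N} {a} {b} below-a below-b preserves {S} S≢⊥ =
  [ through-E , through-m₀ ]′ (m≤n⇒m<n∨m≡n c≤k)
  where
  c = countBelow ((S ⊆?_) ∘ colouring a) N
  m₀,m₀∈S = ≢⊥⇒Nonempty S≢⊥
  m₀ = proj₁ m₀,m₀∈S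
  m₀∈S = proj₂ m₀,m₀∈S
  open ShortIntersection (shortIntersection a m₀∈S)
  member : ∀ (d : Fin n → KSet k) {m x} → m ∈ S → S ⊆ colouring d x → x ∈ˢ d m
  member d m∈S S⊆ = Equivalence.to (∈-colouring {a = d}) (S⊆ m∈S)
  c≤k : c ≤ k
  c≤k = countBelow-≤-size _ (_∈ˢ? a m₀) below-a (∈ˢ-HasSize (a m₀)) (member a m₀∈S)
  through-m₀ : c ≡ k → countBelow ((S ⊆?_) ∘ colouring b) N ≤ c
  through-m₀ c≡k = subst (_ ≤_) (sym c≡k)
    (countBelow-≤-size _ (_∈ˢ? b m₀) below-b (∈ˢ-HasSize (b m₀)) (member b m₀∈S))
  ⋂S⇒⋂t : ∀ {x} → x < N × S ⊆ colouring a x → ∀ l → x ∈ˢ a (t l)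
  ⋂S⇒⋂t (_ , S⊆) l = member a (t∈S l) S⊆
  ⋂S⇔⋂t : ∀ x → (x < N × S ⊆ colouring a x) ⇔ (∀ l → x ∈ˢ a (t l))
  ⋂S⇔⋂t x = mk⇔ ⋂S⇒⋂t (λ x∈⋂ → below-a (x∈⋂ zero) , ⋂t⊆⋂S x∈⋂)
  through-E : c < k → countBelow ((S ⊆?_) ∘ colouring b) N ≤ c
  through-E c<k = countBelow-≤-size _ (λ x → all? λ l → x ∈ˢ? b (t l)) (λ x∈⋂ → below-b (x∈⋂ zero))
                    (preserves c c<k t (HasSize-cong ⋂S⇔⋂t (countBelow-HasSize _ N)))
                    (λ S⊆ l → member b (t∈S l) S⊆)

partialIso⇒SameIntersectionSizes : {a b : Fin n → KSet k} → AllBelow N a → AllBelow N b →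
  PreservesE (suc k) a b → PreservesE (suc k) b a → SameIntersectionSizes N (colouring a) (colouring b)
partialIso⇒SameIntersectionSizes {a = a} {b} below-a below-b a⇒b b⇒a S≢⊥ =
  ≤-antisym (⋂-countBelow-≤ {a = b} {a} below-b below-a b⇒a S≢⊥)
            (⋂-countBelow-≤ {a = a} {b} below-a below-b a⇒b S≢⊥)

≅⇒image-≡ : {a b : Fin n → KSet k} → ((π , _) : colouring a ≅ colouring b) → ∀ m → image π (a m) ≡ b m
≅⇒image-≡ {a = a} {b} (π , π-ok) m = KSet-≡ λ {y} → begin
  (y ∈ˢ image π (a m))            ∼⟨ ∈-image π {x = a m} ⟩
  (from y ∈ˢ a m)                 ∼⟨ ⇔.sym (∈-colouring {a = a}) ⟩
  (m ∈ colouring a (from y))      ≡⟨ cong (m ∈_) (sym (π-ok (from y))) ⟩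
  (m ∈ colouring b (to (from y))) ≡⟨ cong ((m ∈_) ∘ colouring b) (strictlyInverseˡ y) ⟩
  (m ∈ colouring b y)             ∼⟨ ∈-colouring {a = b} ⟩
  (y ∈ˢ b m)                      ∎
  where
  open Inverse π using (to; from; strictlyInverseˡ)
  open EquationalReasoning

proposition3p16 : (k : ℕ) → 1 ≤ k → (n : ℕ) → (a b : Fin n → KSet k) →
    IsFinitePartialIso k n a b →
    Σ (KSet k → KSet k) λ g → IsAutomorphism k g × (∀ m → g (a m) ≡ b m)
proposition3p16 k k≥1 n a b (_ , _ , a≈b) = image π , image-isAutomorphism π , ≅⇒image-≡ a≅b
  where
  M = bound a ⊔ bound b
  below-a : AllBelow M a
  below-a x∈ = <-≤-trans (AllBelow-bound a x∈) (m≤m⊔n (bound a) (bound b))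
  below-b : AllBelow M b
  below-b x∈ = <-≤-trans (AllBelow-bound b x∈) (m≤n⊔m (bound a) (bound b))
  a≅b : colouring a ≅ colouring b
  a≅b = sameIntersectionSizes⇒≅ (colouring-BoundedBy {a = a} below-a) (colouring-BoundedBy {a = b} below-b)
          (partialIso⇒SameIntersectionSizes {a = a} {b} below-a below-b
            (λ j j<k t → Equivalence.to (a≈b _ j (s≤s k≥1 , ≤-refl , j<k) t))
            (λ j j<k t → Equivalence.from (a≈b _ j (s≤s k≥1 , ≤-refl , j<k) t)))
  π = proj₁ a≅b
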